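{- Let $d\geq 3$ be an odd integer and let $0\leq j\leq\frac{d-1}{2}$ be even. Define \[g_j^{(d)}=\binom{(d-1)/2}{j/2}\quad\text{and}\quad h_j^{(d)}=(-1)^j\sum_{i=0}^j(-2)^i\binom{d}{i}\binom{d-1-i}{j-i}.\] Then $h_j^{(d)}\geq d\cdot(g_j^{(d)}-1)+1$. -}

module Defs where

open import Data.Nat using (ℕ; zero; suc; _∸_; _/_)
open import Data.Nat.Combinatorics using (_C_)
open import Data.Integer using (ℤ; +_; -_; _+_; _*_; _^_)
open import Data.List using (List; map; upTo)
import Data.List as L

sumℤ : List ℤ → ℤ
sumℤ = L.foldr _+_ (+ 0)

g : ℕ → ℕ → ℕ
g d j = ((d ∸ 1) / 2) C (j / 2)

-- h_j^{(d)} = (-1)^j Σ_{i=0}^{j} (-2)^i binom(d,i) binom(d-1-i, j-i)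
-- (for 0 ≤ i ≤ j ≤ (d-1)/2 the truncated subtractions are exact)
h : ℕ → ℕ → ℤ
h d j = ((- + 1) ^ j) * sumℤ (map term (upTo (suc j)))
  where
  term : ℕ → ℤ
  term i = ((- + 2) ^ i) * ((+ (d C i)) * (+ ((d ∸ 1 ∸ i) C (j ∸ i))))

{-# OPTIONS --safe #-}
-- Write d = 2m + 1 and j = 2k. Summing Pascal's rule
-- C(d-1-i, j+1-i) + C(d-1-i, j-i) = C(d-i, j+1-i) against (-2)^i C(d,i), and using
-- C(d,i) C(d-i,n-i) = C(d,n) C(n,i) with the binomial theorem for (1 - 2)^n, gives
-- h_{j+1} = h_j + C(d,j+1); so h_j = Σ_{i ≤ j} C(d,i) is a partial binomial sum.
-- For k ≥ 1 its last term alone dominates d C(m,k), and the others contribute at least 1: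
-- by absorption 2k C(d,2k) = d C(2m,2k-1), and by Vandermonde
-- C(2m,2k-1) ≥ C(m,k) C(m,k-1) ≥ 2k C(m,k), since C(m,k-1) ≥ m ≥ 2k once k ≥ 2
-- (for k = 1, C(2m,1) = 2m directly).
module Submission where

open import Defs
open import Data.Nat using (ℕ; zero; suc; _≤_; _<_; _∸_; z≤n; s≤s; _!; _/_; NonZero)
  renaming (_*_ to _*ℕ_; _+_ to _+ℕ_)
open import Data.Nat.Properties
  using ( ≤-refl; ≤-trans; ≤-reflexive; ≤-pred; <⇒≤; <-trans; n<1+n; n≤1+n; m≤m+n; m≤n+m; m∸n≤m
        ; +-mono-≤; +-monoˡ-≤; *-monoˡ-≤; *-monoʳ-≤; *-cancelˡ-≤; *-cancelʳ-≡
        ; +-comm; +-suc; +-identityʳ; *-comm; *-assoc; *-identityˡ; *-zeroʳ; *-distribʳ-+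
        ; +-∸-assoc; ∸-+-assoc; n∸n≡0; m+[n∸m]≡n; ∸-monoˡ-≤
        ; m*n≢0; _!≢0; _!*_!≢0; *-commutativeSemigroup; module ≤-Reasoning )
open import Data.Nat.Combinatorics
  using (_C_; nCk≡n!/k![n-k]!; k![n∸k]!∣n!; nC1≡n; nCk+nC[k+1]≡[n+1]C[k+1])
open import Data.Nat.DivMod using (m/n*n≡m; m*n/n≡m)
open import Data.Nat.Divisibility using (_∣_; divides; _∣0; ∣-refl; ∣m∣n⇒∣m+n)
open import Data.Integer using (ℤ; +_; -_; 1ℤ; _+_; _-_; _*_; _^_; +≤+; +-*-rawSemiring)
  renaming (_≤_ to _≤ℤ_)
import Data.Integer.Properties as ℤ
open import Data.Integer.Tactic.RingSolver using (solve)
open import Data.List using (map; applyUpTo; []; _∷_)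
open import Data.Fin using (toℕ)
open import Data.Fin.Properties using (toℕ<n; toℕ-inject₁; toℕ-fromℕ)
open import Data.Product using (∃-syntax; _,_)
open import Function using (_∘_; id)
open import Relation.Nullary using (¬_; contradiction)
open import Relation.Binary.PropositionalEquality

open import Algebra.Properties.Semiring.Sum ℤ.+-*-semiring
  using (sum-syntax; sum⁺-syntax; sum-cong-≗; sum-init-last; ∑-distrib-+; *-distribˡ-sum)
import Algebra.Properties.CommutativeSemigroup *-commutativeSemigroup as ℕ*
import Algebra.Properties.CommutativeSemigroup ℤ.*-commutativeSemigroup as ℤ*
import Algebra.Properties.CommutativeSemigroup ℤ.+-commutativeSemigroup as ℤ+
import Algebra.Properties.CommutativeSemiring.Binomial ℤ.+-*-commutativeSemiring as Binomial
open import Algebra.Definitions.RawSemiring +-*-rawSemiring using (_×_) renaming (_^_ to _^ᴿ_)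

sumℤ-map-applyUpTo : ∀ (f : ℕ → ℤ) g n → sumℤ (map f (applyUpTo g n)) ≡ ∑[ i < n ] f (g (toℕ i))
sumℤ-map-applyUpTo f g zero    = refl
sumℤ-map-applyUpTo f g (suc n) = cong (_+_ (f (g 0))) (sumℤ-map-applyUpTo f (g ∘ suc) n)

∑-last : ∀ (f : ℕ → ℤ) n → ∑[ i < suc n ] f (toℕ i) ≡ ∑[ i < n ] f (toℕ i) + f n
∑-last f n = trans (sum-init-last {n} (f ∘ toℕ))
  (cong₂ _+_ (sum-cong-≗ {n} (cong f ∘ toℕ-inject₁)) (cong f (toℕ-fromℕ n)))

∑-cong-< : ∀ {f g : ℕ → ℤ} n → (∀ i → i < n → f i ≡ g i) → ∑[ i < n ] f (toℕ i) ≡ ∑[ i < n ] g (toℕ i)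
∑-cong-< n f≗g = sum-cong-≗ (λ i → f≗g (toℕ i) (toℕ<n i))

×≡* : ∀ n x → n × x ≡ + n * x
×≡* zero    x = refl
×≡* (suc n) x = trans (cong (_+_ x) (×≡* n x)) (sym (ℤ.suc-* (+ n) x))

^ᴿ≡^ : ∀ x n → x ^ᴿ n ≡ x ^ n
^ᴿ≡^ x zero    = refl
^ᴿ≡^ x (suc n) = cong (x *_) (^ᴿ≡^ x n)

binomial-theorem : ∀ x n → ∑[ i ≤ n ] (x ^ toℕ i * + (n C toℕ i)) ≡ (x + 1ℤ) ^ n
binomial-theorem x n = begin
  ∑[ i ≤ n ] (x ^ toℕ i * + (n C toℕ i)) ≡⟨ sum-cong-≗ term ⟨
  Binomial.binomialExpansion x 1ℤ n      ≡⟨ Binomial.theorem n x 1ℤ ⟨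
  (x + 1ℤ) ^ᴿ n                          ≡⟨ ^ᴿ≡^ (x + 1ℤ) n ⟩
  (x + 1ℤ) ^ n                           ∎
  where
  open ≡-Reasoning
  term : ∀ i → Binomial.binomialTerm x 1ℤ n i ≡ x ^ toℕ i * + (n C toℕ i)
  term i = let k = toℕ i in begin
    (n C k) × (x ^ᴿ k * 1ℤ ^ᴿ (n ∸ k))   ≡⟨ ×≡* (n C k) _ ⟩
    + (n C k) * (x ^ᴿ k * 1ℤ ^ᴿ (n ∸ k)) ≡⟨ cong₂ (λ a b → + (n C k) * (a * b)) (^ᴿ≡^ x k)
                                              (trans (^ᴿ≡^ 1ℤ (n ∸ k)) (ℤ.^-zeroˡ (n ∸ k))) ⟩
    + (n C k) * (x ^ k * 1ℤ)             ≡⟨ cong (+ (n C k) *_) (ℤ.*-identityʳ (x ^ k)) ⟩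
    + (n C k) * x ^ k                    ≡⟨ ℤ.*-comm (+ (n C k)) (x ^ k) ⟩
    x ^ k * + (n C k)                    ∎

nCk*[k!*[n∸k]!]≡n! : ∀ {n k} → k ≤ n → (n C k) *ℕ (k ! *ℕ (n ∸ k) !) ≡ n !
nCk*[k!*[n∸k]!]≡n! {n} {k} k≤n = begin
  (n C k) *ℕ (k ! *ℕ (n ∸ k) !)                   ≡⟨ cong (_*ℕ (k ! *ℕ (n ∸ k) !)) (nCk≡n!/k![n-k]! k≤n) ⟩
  n ! / (k ! *ℕ (n ∸ k) !) *ℕ (k ! *ℕ (n ∸ k) !) ≡⟨ m/n*n≡m (k![n∸k]!∣n! k≤n) ⟩
  n !                                           ∎
  where
  open ≡-Reasoning
  instance _ = k !* (n ∸ k) !≢0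

dCi*[d∸i]C[n∸i]≡dCn*nCi : ∀ {d n i} → i ≤ n → n ≤ d → (d C i) *ℕ ((d ∸ i) C (n ∸ i)) ≡ (d C n) *ℕ (n C i)
dCi*[d∸i]C[n∸i]≡dCn*nCi {d} {n} {i} i≤n n≤d =
  *-cancelʳ-≡ _ _ (i ! *ℕ ((n ∸ i) ! *ℕ (d ∸ n) !)) {{nonZero}} (trans lhs≡d! (sym rhs≡d!))
  where
  open ≡-Reasoning
  nonZero : NonZero (i ! *ℕ ((n ∸ i) ! *ℕ (d ∸ n) !))
  nonZero = m*n≢0 (i !) _ {{i !≢0}} {{(n ∸ i) !* (d ∸ n) !≢0}}
  [d∸i]∸[n∸i]≡d∸n : d ∸ i ∸ (n ∸ i) ≡ d ∸ n
  [d∸i]∸[n∸i]≡d∸n = trans (∸-+-assoc d i (n ∸ i)) (cong (d ∸_) (m+[n∸m]≡n i≤n))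
  lhs≡d! : (d C i) *ℕ ((d ∸ i) C (n ∸ i)) *ℕ (i ! *ℕ ((n ∸ i) ! *ℕ (d ∸ n) !)) ≡ d !
  lhs≡d! = begin
    (d C i) *ℕ ((d ∸ i) C (n ∸ i)) *ℕ (i ! *ℕ ((n ∸ i) ! *ℕ (d ∸ n) !))
      ≡⟨ ℕ*.interchange (d C i) _ (i !) _ ⟩
    (d C i) *ℕ i ! *ℕ (((d ∸ i) C (n ∸ i)) *ℕ ((n ∸ i) ! *ℕ (d ∸ n) !))
      ≡⟨ cong (λ e → (d C i) *ℕ i ! *ℕ (((d ∸ i) C (n ∸ i)) *ℕ ((n ∸ i) ! *ℕ e !))) (sym [d∸i]∸[n∸i]≡d∸n) ⟩
    (d C i) *ℕ i ! *ℕ (((d ∸ i) C (n ∸ i)) *ℕ ((n ∸ i) ! *ℕ (d ∸ i ∸ (n ∸ i)) !))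
      ≡⟨ cong ((d C i) *ℕ i ! *ℕ_) (nCk*[k!*[n∸k]!]≡n! (∸-monoˡ-≤ i n≤d)) ⟩
    (d C i) *ℕ i ! *ℕ (d ∸ i) !
      ≡⟨ *-assoc (d C i) (i !) _ ⟩
    (d C i) *ℕ (i ! *ℕ (d ∸ i) !)
      ≡⟨ nCk*[k!*[n∸k]!]≡n! (≤-trans i≤n n≤d) ⟩
    d ! ∎
  rhs≡d! : (d C n) *ℕ (n C i) *ℕ (i ! *ℕ ((n ∸ i) ! *ℕ (d ∸ n) !)) ≡ d !
  rhs≡d! = begin
    (d C n) *ℕ (n C i) *ℕ (i ! *ℕ ((n ∸ i) ! *ℕ (d ∸ n) !))
      ≡⟨ cong ((d C n) *ℕ (n C i) *ℕ_) (*-assoc (i !) _ _) ⟨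
    (d C n) *ℕ (n C i) *ℕ (i ! *ℕ (n ∸ i) ! *ℕ (d ∸ n) !)
      ≡⟨ *-assoc (d C n) (n C i) _ ⟩
    (d C n) *ℕ ((n C i) *ℕ (i ! *ℕ (n ∸ i) ! *ℕ (d ∸ n) !))
      ≡⟨ cong ((d C n) *ℕ_) (*-assoc (n C i) _ _) ⟨
    (d C n) *ℕ ((n C i) *ℕ (i ! *ℕ (n ∸ i) !) *ℕ (d ∸ n) !)
      ≡⟨ cong (λ e → (d C n) *ℕ (e *ℕ (d ∸ n) !)) (nCk*[k!*[n∸k]!]≡n! i≤n) ⟩
    (d C n) *ℕ (n ! *ℕ (d ∸ n) !)
      ≡⟨ nCk*[k!*[n∸k]!]≡n! n≤d ⟩
    d ! ∎

[1+k]*[1+n]C[1+k]≡[1+n]*nCk : ∀ {n k} → k ≤ n → suc k *ℕ (suc n C suc k) ≡ suc n *ℕ (n C k)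
[1+k]*[1+n]C[1+k]≡[1+n]*nCk {n} {k} k≤n =
  *-cancelʳ-≡ _ _ (k ! *ℕ (n ∸ k) !) {{k !* (n ∸ k) !≢0}} (begin
    suc k *ℕ (suc n C suc k) *ℕ (k ! *ℕ (n ∸ k) !)   ≡⟨ cong (_*ℕ (k ! *ℕ (n ∸ k) !)) (*-comm (suc k) (suc n C suc k)) ⟩
    (suc n C suc k) *ℕ suc k *ℕ (k ! *ℕ (n ∸ k) !)   ≡⟨ *-assoc (suc n C suc k) (suc k) _ ⟩
    (suc n C suc k) *ℕ (suc k *ℕ (k ! *ℕ (n ∸ k) !)) ≡⟨ cong ((suc n C suc k) *ℕ_) (*-assoc (suc k) (k !) _) ⟨
    (suc n C suc k) *ℕ (suc k *ℕ k ! *ℕ (n ∸ k) !)   ≡⟨ nCk*[k!*[n∸k]!]≡n! (s≤s k≤n) ⟩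
    suc n *ℕ n !                                   ≡⟨ cong (suc n *ℕ_) (nCk*[k!*[n∸k]!]≡n! k≤n) ⟨
    suc n *ℕ ((n C k) *ℕ (k ! *ℕ (n ∸ k) !))        ≡⟨ *-assoc (suc n) (n C k) _ ⟨
    suc n *ℕ (n C k) *ℕ (k ! *ℕ (n ∸ k) !)          ∎)
  where open ≡-Reasoning

aCr*bCs≤[a+b]C[r+s] : ∀ a b r s → (a C r) *ℕ (b C s) ≤ (a +ℕ b) C (r +ℕ s)
aCr*bCs≤[a+b]C[r+s] zero    b zero    s = ≤-reflexive (*-identityˡ (b C s))
aCr*bCs≤[a+b]C[r+s] zero    b (suc r) s = z≤n
aCr*bCs≤[a+b]C[r+s] (suc a) b zero    zero    = ≤-refl
aCr*bCs≤[a+b]C[r+s] (suc a) b zero    (suc s) = begin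
  1 *ℕ (b C suc s)                          ≤⟨ aCr*bCs≤[a+b]C[r+s] a b zero (suc s) ⟩
  (a +ℕ b) C suc s                          ≤⟨ m≤n+m _ _ ⟩
  (a +ℕ b) C s +ℕ (a +ℕ b) C suc s          ≡⟨ nCk+nC[k+1]≡[n+1]C[k+1] (a +ℕ b) s ⟩
  suc (a +ℕ b) C suc s                      ∎
  where open ≤-Reasoning
aCr*bCs≤[a+b]C[r+s] (suc a) b (suc r) s = begin
  (suc a C suc r) *ℕ (b C s)                        ≡⟨ cong (_*ℕ (b C s)) (nCk+nC[k+1]≡[n+1]C[k+1] a r) ⟨
  ((a C r) +ℕ (a C suc r)) *ℕ (b C s)               ≡⟨ *-distribʳ-+ (b C s) (a C r) _ ⟩
  (a C r) *ℕ (b C s) +ℕ (a C suc r) *ℕ (b C s)      ≤⟨ +-mono-≤ (aCr*bCs≤[a+b]C[r+s] a b r s)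
                                                               (aCr*bCs≤[a+b]C[r+s] a b (suc r) s) ⟩
  (a +ℕ b) C (r +ℕ s) +ℕ (a +ℕ b) C suc (r +ℕ s)    ≡⟨ nCk+nC[k+1]≡[n+1]C[k+1] (a +ℕ b) (r +ℕ s) ⟩
  suc (a +ℕ b) C suc (r +ℕ s)                       ∎
  where open ≤-Reasoning

k≤n⇒0<nCk : ∀ {n k} → k ≤ n → 0 < n C k
k≤n⇒0<nCk {n}     {zero}  _         = s≤s z≤n
k≤n⇒0<nCk {suc n} {suc k} (s≤s k≤n) =
  subst (0 <_) (nCk+nC[k+1]≡[n+1]C[k+1] n k) (≤-trans (k≤n⇒0<nCk k≤n) (m≤m+n _ _))

k<n⇒1+n≤[1+n]C[1+k] : ∀ {n k} → k < n → suc n ≤ suc n C suc k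
k<n⇒1+n≤[1+n]C[1+k] {n}     {zero}  _         = ≤-reflexive (sym (nC1≡n (suc n)))
k<n⇒1+n≤[1+n]C[1+k] {suc n} {suc k} (s≤s k<n) = begin
  suc (suc n)                                  ≡⟨ +-comm 1 (suc n) ⟩
  suc n +ℕ 1                                   ≤⟨ +-mono-≤ (k<n⇒1+n≤[1+n]C[1+k] k<n) (k≤n⇒0<nCk (s≤s k<n)) ⟩
  (suc n C suc k) +ℕ (suc n C suc (suc k))     ≡⟨ nCk+nC[k+1]≡[n+1]C[k+1] (suc n) (suc k) ⟩
  suc (suc n) C suc (suc k)                    ∎
  where open ≤-Reasoning

2*n≡n+n : ∀ n → 2 *ℕ n ≡ n +ℕ n
2*n≡n+n n = cong (n +ℕ_) (+-identityʳ n)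

2k*mCk≤[2m]C[2k-1] : ∀ m k → 0 < k → k +ℕ k ≤ m → (k +ℕ k) *ℕ (m C k) ≤ (m +ℕ m) C (k +ℕ k ∸ 1)
2k*mCk≤[2m]C[2k-1] m 1 _ _ = ≤-reflexive (begin
  2 *ℕ (m C 1)    ≡⟨ cong (2 *ℕ_) (nC1≡n m) ⟩
  2 *ℕ m          ≡⟨ 2*n≡n+n m ⟩
  m +ℕ m          ≡⟨ nC1≡n (m +ℕ m) ⟨
  (m +ℕ m) C 1    ∎)
  where open ≡-Reasoning
2k*mCk≤[2m]C[2k-1] m@(suc n) k@(suc k′@(suc r)) _ 2k≤m@(s≤s 2k-1≤n) = begin
  (k +ℕ k) *ℕ (m C k)     ≤⟨ *-monoˡ-≤ (m C k) (≤-trans 2k≤m m≤mCk′) ⟩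
  (m C k′) *ℕ (m C k)     ≡⟨ *-comm (m C k′) (m C k) ⟩
  (m C k) *ℕ (m C k′)     ≤⟨ aCr*bCs≤[a+b]C[r+s] m m k k′ ⟩
  (m +ℕ m) C (k +ℕ k′)    ≡⟨ cong ((m +ℕ m) C_) (+-comm k k′) ⟩
  (m +ℕ m) C (k′ +ℕ k)    ∎
  where
  open ≤-Reasoning
  m≤mCk′ : m ≤ m C k′
  m≤mCk′ = k<n⇒1+n≤[1+n]C[1+k] (≤-trans (s≤s (m≤m+n r _)) 2k-1≤n)

[1+2m]*mCk≤[1+2m]C[2k] : ∀ m k → 0 < k → k +ℕ k ≤ m → suc (m +ℕ m) *ℕ (m C k) ≤ suc (m +ℕ m) C (k +ℕ k)
[1+2m]*mCk≤[1+2m]C[2k] m k@(suc k′) 0<k 2k≤m = *-cancelˡ-≤ (k +ℕ k) (begin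
  (k +ℕ k) *ℕ (suc (m +ℕ m) *ℕ (m C k))     ≡⟨ ℕ*.x∙yz≈y∙xz (k +ℕ k) (suc (m +ℕ m)) _ ⟩
  suc (m +ℕ m) *ℕ ((k +ℕ k) *ℕ (m C k))     ≤⟨ *-monoʳ-≤ (suc (m +ℕ m)) (2k*mCk≤[2m]C[2k-1] m k 0<k 2k≤m) ⟩
  suc (m +ℕ m) *ℕ ((m +ℕ m) C (k′ +ℕ k))    ≡⟨ [1+k]*[1+n]C[1+k]≡[1+n]*nCk 2k-1≤2m ⟨
  (k +ℕ k) *ℕ (suc (m +ℕ m) C (k +ℕ k))     ∎)
  where
  open ≤-Reasoning
  2k-1≤2m : k′ +ℕ k ≤ m +ℕ m
  2k-1≤2m = ≤-trans (n≤1+n _) (≤-trans 2k≤m (m≤m+n m m))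

partialBinomialSum : ℕ → ℕ → ℕ
partialBinomialSum d zero    = 1
partialBinomialSum d (suc j) = partialBinomialSum d j +ℕ d C suc j

1≤partialBinomialSum : ∀ d j → 1 ≤ partialBinomialSum d j
1≤partialBinomialSum d zero    = ≤-refl
1≤partialBinomialSum d (suc j) = ≤-trans (1≤partialBinomialSum d j) (m≤m+n _ _)

odd-partialBinomialSum-bound : ∀ m k → k +ℕ k ≤ m →
  suc (m +ℕ m) *ℕ (m C k ∸ 1) +ℕ 1 ≤ partialBinomialSum (suc (m +ℕ m)) (k +ℕ k)
odd-partialBinomialSum-bound m zero    _   = ≤-reflexive (cong (_+ℕ 1) (*-zeroʳ (suc (m +ℕ m))))
odd-partialBinomialSum-bound m k@(suc k′) 2k≤m = begin
  D *ℕ (m C k ∸ 1) +ℕ 1                             ≤⟨ +-monoˡ-≤ 1 (*-monoʳ-≤ D (m∸n≤m (m C k) 1)) ⟩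
  D *ℕ (m C k) +ℕ 1                                 ≤⟨ +-mono-≤ ([1+2m]*mCk≤[1+2m]C[2k] m k (s≤s z≤n) 2k≤m)
                                                                (1≤partialBinomialSum D (k′ +ℕ k)) ⟩
  D C (k +ℕ k) +ℕ partialBinomialSum D (k′ +ℕ k)    ≡⟨ +-comm (D C (k +ℕ k)) _ ⟩
  partialBinomialSum D (k +ℕ k)                     ∎
  where
  open ≤-Reasoning
  D : ℕ
  D = suc (m +ℕ m)

hSummand : ℕ → ℕ → ℕ → ℤ
hSummand d j i = (- + 2) ^ i * (+ (d C i) * + ((d ∸ 1 ∸ i) C (j ∸ i)))

pascalSummand : ℕ → ℕ → ℕ → ℤ
pascalSummand d n i = (- + 2) ^ i * (+ (d C i) * + ((d ∸ i) C (n ∸ i)))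

hSum : ℕ → ℕ → ℤ
hSum d j = ∑[ i ≤ j ] hSummand d j (toℕ i)

h≡[-1]^j*hSum : ∀ d j → h d j ≡ (- + 1) ^ j * hSum d j
h≡[-1]^j*hSum d j = cong ((- + 1) ^ j *_) (sumℤ-map-applyUpTo (hSummand d j) id (suc j))

∑x^i*dCi*[d∸i]C[n∸i]≡dCn*[x+1]^n : ∀ x {d n} → n ≤ d →
  ∑[ i ≤ n ] (x ^ toℕ i * (+ (d C toℕ i) * + ((d ∸ toℕ i) C (n ∸ toℕ i)))) ≡ + (d C n) * (x + 1ℤ) ^ n
∑x^i*dCi*[d∸i]C[n∸i]≡dCn*[x+1]^n x {d} {n} n≤d = begin
  ∑[ i ≤ n ] (x ^ toℕ i * (+ (d C toℕ i) * + ((d ∸ toℕ i) C (n ∸ toℕ i))))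
    ≡⟨ sum-cong-≗ (λ i → summand (≤-pred (toℕ<n i))) ⟩
  ∑[ i ≤ n ] (+ (d C n) * (x ^ toℕ i * + (n C toℕ i)))
    ≡⟨ *-distribˡ-sum {suc n} (+ (d C n)) (λ i → x ^ toℕ i * + (n C toℕ i)) ⟨
  + (d C n) * ∑[ i ≤ n ] (x ^ toℕ i * + (n C toℕ i))
    ≡⟨ cong (+ (d C n) *_) (binomial-theorem x n) ⟩
  + (d C n) * (x + 1ℤ) ^ n ∎
  where
  open ≡-Reasoning
  summand : ∀ {i} → i ≤ n → x ^ i * (+ (d C i) * + ((d ∸ i) C (n ∸ i))) ≡ + (d C n) * (x ^ i * + (n C i))
  summand {i} i≤n = begin
    x ^ i * (+ (d C i) * + ((d ∸ i) C (n ∸ i))) ≡⟨ cong (x ^ i *_) (ℤ.pos-* (d C i) _) ⟨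
    x ^ i * + ((d C i) *ℕ ((d ∸ i) C (n ∸ i)))  ≡⟨ cong (λ e → x ^ i * + e) (dCi*[d∸i]C[n∸i]≡dCn*nCi i≤n n≤d) ⟩
    x ^ i * + ((d C n) *ℕ (n C i))              ≡⟨ cong (x ^ i *_) (ℤ.pos-* (d C n) (n C i)) ⟩
    x ^ i * (+ (d C n) * + (n C i))             ≡⟨ ℤ*.x∙yz≈y∙xz (x ^ i) (+ (d C n)) _ ⟩
    + (d C n) * (x ^ i * + (n C i))             ∎

[d∸1∸i]C[j∸i]-pascal : ∀ {d i j} → i ≤ j → j < d →
  (d ∸ 1 ∸ i) C (suc j ∸ i) +ℕ (d ∸ 1 ∸ i) C (j ∸ i) ≡ (d ∸ i) C (suc j ∸ i)
[d∸1∸i]C[j∸i]-pascal {d} {i} {j} i≤j j<d = begin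
  (d ∸ 1 ∸ i) C (suc j ∸ i) +ℕ (d ∸ 1 ∸ i) C (j ∸ i)
    ≡⟨ cong₂ (λ n k → n C k +ℕ n C (j ∸ i)) (∸-+-assoc d 1 i) (+-∸-assoc 1 i≤j) ⟩
  (d ∸ suc i) C suc (j ∸ i) +ℕ (d ∸ suc i) C (j ∸ i)
    ≡⟨ +-comm ((d ∸ suc i) C suc (j ∸ i)) _ ⟩
  (d ∸ suc i) C (j ∸ i) +ℕ (d ∸ suc i) C suc (j ∸ i)
    ≡⟨ nCk+nC[k+1]≡[n+1]C[k+1] (d ∸ suc i) (j ∸ i) ⟩
  suc (d ∸ suc i) C suc (j ∸ i)
    ≡⟨ cong₂ _C_ (+-∸-assoc 1 (≤-trans (s≤s i≤j) j<d)) (+-∸-assoc 1 i≤j) ⟨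
  (d ∸ i) C (suc j ∸ i) ∎
  where open ≡-Reasoning

hSummand-pascal : ∀ d {i j} → i ≤ j → j < d → hSummand d (suc j) i + hSummand d j i ≡ pascalSummand d (suc j) i
hSummand-pascal d {i} {j} i≤j j<d = begin
  x * (A * + ((d ∸ 1 ∸ i) C (suc j ∸ i))) + x * (A * + ((d ∸ 1 ∸ i) C (j ∸ i)))
    ≡⟨ ℤ.*-distribˡ-+ x _ _ ⟨
  x * (A * + ((d ∸ 1 ∸ i) C (suc j ∸ i)) + A * + ((d ∸ 1 ∸ i) C (j ∸ i)))
    ≡⟨ cong (x *_) (ℤ.*-distribˡ-+ A _ _) ⟨
  x * (A * (+ ((d ∸ 1 ∸ i) C (suc j ∸ i)) + + ((d ∸ 1 ∸ i) C (j ∸ i))))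
    ≡⟨ cong (λ e → x * (A * e)) (ℤ.pos-+ ((d ∸ 1 ∸ i) C (suc j ∸ i)) _) ⟨
  x * (A * + ((d ∸ 1 ∸ i) C (suc j ∸ i) +ℕ (d ∸ 1 ∸ i) C (j ∸ i)))
    ≡⟨ cong (λ e → x * (A * + e)) ([d∸1∸i]C[j∸i]-pascal i≤j j<d) ⟩
  x * (A * + ((d ∸ i) C (suc j ∸ i))) ∎
  where
  open ≡-Reasoning
  x A : ℤ
  x = (- + 2) ^ i
  A = + (d C i)

hSummand-last : ∀ d j → hSummand d j j ≡ pascalSummand d j j
hSummand-last d j rewrite n∸n≡0 j = refl

hSum-recurrence : ∀ d j → suc j ≤ d → hSum d (suc j) + hSum d j ≡ (- + 1) ^ suc j * + (d C suc j)
hSum-recurrence d j 1+j≤d = begin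
  ∑[ i ≤ suc j ] t₁ (toℕ i) + ∑[ i ≤ j ] t₀ (toℕ i)
    ≡⟨ cong (_+ ∑[ i ≤ j ] t₀ (toℕ i)) (∑-last t₁ (suc j)) ⟩
  ∑[ i ≤ j ] t₁ (toℕ i) + t₁ (suc j) + ∑[ i ≤ j ] t₀ (toℕ i)
    ≡⟨ ℤ+.xy∙z≈xz∙y (∑[ i ≤ j ] t₁ (toℕ i)) _ _ ⟩
  ∑[ i ≤ j ] t₁ (toℕ i) + ∑[ i ≤ j ] t₀ (toℕ i) + t₁ (suc j)
    ≡⟨ cong₂ _+_ (sym (∑-distrib-+ {suc j} (t₁ ∘ toℕ) (t₀ ∘ toℕ))) (hSummand-last d (suc j)) ⟩
  ∑[ i ≤ j ] (t₁ (toℕ i) + t₀ (toℕ i)) + u (suc j)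
    ≡⟨ cong (_+ u (suc j)) (∑-cong-< (suc j) λ i i<1+j → hSummand-pascal d (≤-pred i<1+j) 1+j≤d) ⟩
  ∑[ i ≤ j ] u (toℕ i) + u (suc j)
    ≡⟨ ∑-last u (suc j) ⟨
  ∑[ i ≤ suc j ] u (toℕ i)
    ≡⟨ ∑x^i*dCi*[d∸i]C[n∸i]≡dCn*[x+1]^n (- + 2) 1+j≤d ⟩
  + (d C suc j) * (- + 1) ^ suc j
    ≡⟨ ℤ.*-comm (+ (d C suc j)) _ ⟩
  (- + 1) ^ suc j * + (d C suc j) ∎
  where
  open ≡-Reasoning
  t₁ t₀ u : ℕ → ℤ
  t₁ = hSummand d (suc j)
  t₀ = hSummand d j
  u  = pascalSummand d (suc j)

[-1]^n*[-1]^n≡1 : ∀ n → (- + 1) ^ n * (- + 1) ^ n ≡ 1ℤ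
[-1]^n*[-1]^n≡1 zero    = refl
[-1]^n*[-1]^n≡1 (suc n) = trans (square-neg ((- + 1) ^ n)) ([-1]^n*[-1]^n≡1 n)
  where
  square-neg : ∀ s → (- + 1) * s * ((- + 1) * s) ≡ s * s
  square-neg s = solve (s ∷ [])

h-suc : ∀ d j → suc j ≤ d → h d (suc j) ≡ h d j + + (d C suc j)
h-suc d j 1+j≤d = begin
  h d (suc j)                            ≡⟨ h≡[-1]^j*hSum d (suc j) ⟩
  (- + 1) * (- + 1) ^ j * hSum d (suc j) ≡⟨ flip-sign ((- + 1) ^ j) _ _ _ ([-1]^n*[-1]^n≡1 j) (hSum-recurrence d j 1+j≤d) ⟩
  (- + 1) ^ j * hSum d j + + (d C suc j) ≡⟨ cong (_+ + (d C suc j)) (h≡[-1]^j*hSum d j) ⟨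
  h d j + + (d C suc j)                  ∎
  where
  open ≡-Reasoning
  flip-sign : ∀ s S S′ c → s * s ≡ 1ℤ → S′ + S ≡ (- + 1) * s * c → (- + 1) * s * S′ ≡ s * S + c
  flip-sign s S S′ c s²≡1 S′+S≡[-s]*c = begin
    (- + 1) * s * S′                        ≡⟨ solve (s ∷ S ∷ S′ ∷ []) ⟩
    (- + 1) * s * (S′ + S) + s * S          ≡⟨ cong (λ e → (- + 1) * s * e + s * S) S′+S≡[-s]*c ⟩
    (- + 1) * s * ((- + 1) * s * c) + s * S ≡⟨ solve (s ∷ S ∷ c ∷ []) ⟩
    s * s * c + s * S                       ≡⟨ cong (λ e → e * c + s * S) s²≡1 ⟩
    1ℤ * c + s * S                          ≡⟨ solve (s ∷ S ∷ c ∷ []) ⟩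
    s * S + c                               ∎

h≡partialBinomialSum : ∀ d j → j < d → h d j ≡ + partialBinomialSum d j
h≡partialBinomialSum d zero    _     = refl
h≡partialBinomialSum d (suc j) 1+j<d = begin
  h d (suc j)                                   ≡⟨ h-suc d j (<⇒≤ 1+j<d) ⟩
  h d j + + (d C suc j)                         ≡⟨ cong (_+ + (d C suc j)) (h≡partialBinomialSum d j (<-trans (n<1+n j) 1+j<d)) ⟩
  + partialBinomialSum d j + + (d C suc j)      ≡⟨ ℤ.pos-+ (partialBinomialSum d j) _ ⟨
  + partialBinomialSum d (suc j)                ∎
  where open ≡-Reasoning

n*2≡n+n : ∀ n → n *ℕ 2 ≡ n +ℕ n
n*2≡n+n n = trans (*-comm n 2) (2*n≡n+n n)

[n+n]/2≡n : ∀ n → (n +ℕ n) / 2 ≡ n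
[n+n]/2≡n n = trans (cong (_/ 2) (sym (n*2≡n+n n))) (m*n/n≡m n 2)

¬2∣n⇒n≡1+m+m : ∀ n → ¬ 2 ∣ n → ∃[ m ] n ≡ suc (m +ℕ m)
¬2∣n⇒n≡1+m+m zero          ¬2∣0   = contradiction (2 ∣0) ¬2∣0
¬2∣n⇒n≡1+m+m (suc zero)    _      = 0 , refl
¬2∣n⇒n≡1+m+m (suc (suc n)) ¬2∣2+n with ¬2∣n⇒n≡1+m+m n (¬2∣2+n ∘ ∣m∣n⇒∣m+n ∣-refl)
... | m , refl = suc m , cong (suc ∘ suc) (sym (+-suc m m))

2∣n⇒n≡k+k : ∀ {n} → 2 ∣ n → ∃[ k ] n ≡ k +ℕ k
2∣n⇒n≡k+k (divides k n≡k*2) = k , trans n≡k*2 (n*2≡n+n k)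

+a*[+b-1]+1≡+[a*[b∸1]+1] : ∀ a {b} → 0 < b → + a * (+ b - + 1) + + 1 ≡ + (a *ℕ (b ∸ 1) +ℕ 1)
+a*[+b-1]+1≡+[a*[b∸1]+1] a {suc b} _ = trans (cong (_+ + 1) (sym (ℤ.pos-* a b))) (sym (ℤ.pos-+ (a *ℕ b) 1))

lemma3p5 : (d j : ℕ) → 3 ≤ d → ¬ (2 ∣ d) → 2 ∣ j → 2 *ℕ j ≤ d ∸ 1 →
    (+ d) * ((+ g d j) - (+ 1)) + (+ 1) ≤ℤ h d j
lemma3p5 d j _ ¬2∣d 2∣j 2j≤d∸1 with ¬2∣n⇒n≡1+m+m d ¬2∣d | 2∣n⇒n≡k+k 2∣j
... | m , refl | k , refl = begin
  + D * (+ g D (k +ℕ k) - + 1) + + 1 ≡⟨ cong (λ e → + D * (+ e - + 1) + + 1) (cong₂ _C_ ([n+n]/2≡n m) ([n+n]/2≡n k)) ⟩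
  + D * (+ (m C k) - + 1) + + 1      ≡⟨ +a*[+b-1]+1≡+[a*[b∸1]+1] D (k≤n⇒0<nCk (≤-trans (m≤m+n k k) 2k≤m)) ⟩
  + (D *ℕ (m C k ∸ 1) +ℕ 1)          ≤⟨ +≤+ (odd-partialBinomialSum-bound m k 2k≤m) ⟩
  + partialBinomialSum D (k +ℕ k)    ≡⟨ h≡partialBinomialSum D (k +ℕ k) (s≤s (≤-trans 2k≤m (m≤m+n m m))) ⟨
  h D (k +ℕ k)                       ∎
  where
  open ℤ.≤-Reasoning
  D : ℕ
  D = suc (m +ℕ m)
  2k≤m : k +ℕ k ≤ m
  2k≤m = *-cancelˡ-≤ 2 (subst (2 *ℕ (k +ℕ k) ≤_) (sym (2*n≡n+n m)) 2j≤d∸1)
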